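{- The axioms (F1) $\mathsf F=\neg\mathsf T$ and (F3) $\neg\neg x=x$ are derivable in equational logic from the axioms (F2), (F4), (F5), (F6), (F7), (F9) alone, where (F2) $x\vee y=\neg(\neg x\wedge\neg y)$; (F4) $\mathsf T\wedge x=x$; (F5) $x\vee\mathsf F=x$; (F6) $\mathsf F\wedge x=\mathsf F$; (F7) $(x\wedge y)\wedge z=x\wedge(y\wedge z)$; (F9) $(x\wedge\mathsf F)\vee y=(x\vee\mathsf T)\wedge y$.
   Context: Terms are over the signature with constants $\mathsf T,\mathsf F$ (and atom constants), unary $\neg$ and binary $\wedge,\vee$ (left-sequential conjunction and disjunction), with variables. Derivability is in equational logic (reflexivity, symmetry, transitivity, congruence, substitution). -}

module Defs where

open import Data.Nat using (ℕ)
open import Data.Product using (_×_; _,_)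
open import Level using (Level; suc; _⊔_)
open import Relation.Unary using (Pred)

-- Terms over the signature T, F, atom constants (from a set A),
-- unary ¬, binary ∧, ∨ (left-sequential), with variables indexed by ℕ.
data Term (A : Set) : Set where
  var : ℕ → Term A
  atm : A → Term A
  `T  : Term A
  `F  : Term A
  ¬'_ : Term A → Term A
  _∧'_ : Term A → Term A → Term A
  _∨'_ : Term A → Term A → Term A

infix  9 ¬'_
infixl 7 _∧'_
infixl 6 _∨'_

Eqn : Set → Set
Eqn A = Term A × Term A

Subst : Set → Set
Subst A = ℕ → Term A

_[_] : ∀ {A} → Term A → Subst A → Term A
var x [ σ ] = σ x
atm a [ σ ] = atm a
`T [ σ ] = `T
`F [ σ ] = `F
(¬' t) [ σ ] = ¬' (t [ σ ])
(t ∧' u) [ σ ] = (t [ σ ]) ∧' (u [ σ ])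
(t ∨' u) [ σ ] = (t [ σ ]) ∨' (u [ σ ])

infix 4 _⊢_≈_

data _⊢_≈_ {A : Set} {ℓ : Level} (E : Pred (Eqn A) ℓ) : Term A → Term A → Set ℓ where
  axiom : ∀ {s t} → E (s , t) → E ⊢ s ≈ t
  refl  : ∀ {t} → E ⊢ t ≈ t
  sym   : ∀ {s t} → E ⊢ s ≈ t → E ⊢ t ≈ s
  trans : ∀ {s t u} → E ⊢ s ≈ t → E ⊢ t ≈ u → E ⊢ s ≈ u
  cong¬ : ∀ {s t} → E ⊢ s ≈ t → E ⊢ ¬' s ≈ ¬' t
  cong∧ : ∀ {s s' t t'} → E ⊢ s ≈ s' → E ⊢ t ≈ t' → E ⊢ s ∧' t ≈ s' ∧' t'
  cong∨ : ∀ {s s' t t'} → E ⊢ s ≈ s' → E ⊢ t ≈ t' → E ⊢ s ∨' t ≈ s' ∨' t'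
  subst : ∀ {s t} (σ : Subst A) → E ⊢ s ≈ t → E ⊢ s [ σ ] ≈ t [ σ ]

x y z : ∀ {A} → Term A
x = var 0
y = var 1
z = var 2

data Ax (A : Set) : Pred (Eqn A) Level.zero where
  F2 : Ax A (x ∨' y , ¬' (¬' x ∧' ¬' y))
  F4 : Ax A (`T ∧' x , x)
  F5 : Ax A (x ∨' `F , x)
  F6 : Ax A (`F ∧' x , `F)
  F7 : Ax A ((x ∧' y) ∧' z , x ∧' (y ∧' z))
  F9 : Ax A ((x ∧' `F) ∨' y , (x ∨' `T) ∧' y)

module Submission where

open import Data.Nat using (zero; suc)
open import Data.Product using (_×_; _,_)
open import Level using (0ℓ)
open import Relation.Binary.Bundles using (Setoid)
open import Defs

-- Writing n for ¬F, the axioms F2 and F5 give ¬(¬a ∧ n) = a ∨ F = a, so ¬(- ∧ n) undoes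
-- ¬, and hence (¬a ∧ n) ∨ b = ¬(a ∧ ¬b).  Taking a = F (with F6) and a = T (with F4)
-- yields first ¬n = F and then ¬T ∧ n = F, whence T = ¬(¬T ∧ n) = n and F = ¬n = ¬T.
-- For F3, F9 turns F ∨ b = (F ∧ F) ∨ b into (F ∨ T) ∧ b = T ∧ b = b, and
-- ¬¬b = (¬T ∧ n) ∨ b = F ∨ b = b.

module _ (A : Set) where

  infix 4 _≈_

  _≈_ : Term A → Term A → Set
  s ≈ t = Ax A ⊢ s ≈ t

  ≈-setoid : Setoid 0ℓ 0ℓ
  ≈-setoid = record
    { Carrier       = Term A
    ; _≈_           = _≈_
    ; isEquivalence = record { refl = refl ; sym = sym ; trans = trans }
    }

  open import Relation.Binary.Reasoning.Setoid ≈-setoid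

  ⟨_,_⟩ : Term A → Term A → Subst A
  ⟨ a , b ⟩ zero    = a
  ⟨ a , b ⟩ (suc _) = b

  ∨-definition : ∀ a b → a ∨' b ≈ ¬' (¬' a ∧' ¬' b)
  ∨-definition a b = subst ⟨ a , b ⟩ (axiom F2)

  ∧-identityˡ : ∀ a → `T ∧' a ≈ a
  ∧-identityˡ a = subst ⟨ a , a ⟩ (axiom F4)

  ∨-identityʳ : ∀ a → a ∨' `F ≈ a
  ∨-identityʳ a = subst ⟨ a , a ⟩ (axiom F5)

  ∧-zeroˡ : ∀ a → `F ∧' a ≈ `F
  ∧-zeroˡ a = subst ⟨ a , a ⟩ (axiom F6)

  [∧F]∨≈[∨T]∧ : ∀ a b → (a ∧' `F) ∨' b ≈ (a ∨' `T) ∧' b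
  [∧F]∨≈[∨T]∧ a b = subst ⟨ a , b ⟩ (axiom F9)

  ¬[¬a∧¬F]≈a : ∀ a → ¬' (¬' a ∧' ¬' `F) ≈ a
  ¬[¬a∧¬F]≈a a = begin
    ¬' (¬' a ∧' ¬' `F) ≈⟨ ∨-definition a `F ⟨
    a ∨' `F            ≈⟨ ∨-identityʳ a ⟩
    a                  ∎

  [¬a∧¬F]∨b≈¬[a∧¬b] : ∀ a b → (¬' a ∧' ¬' `F) ∨' b ≈ ¬' (a ∧' ¬' b)
  [¬a∧¬F]∨b≈¬[a∧¬b] a b = begin
    (¬' a ∧' ¬' `F) ∨' b                 ≈⟨ ∨-definition _ b ⟩
    ¬' (¬' (¬' a ∧' ¬' `F) ∧' ¬' b)      ≈⟨ cong¬ (cong∧ (¬[¬a∧¬F]≈a a) refl) ⟩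
    ¬' (a ∧' ¬' b)                       ∎

  ¬F∧¬F≈¬F : ¬' `F ∧' ¬' `F ≈ ¬' `F
  ¬F∧¬F≈¬F = begin
    ¬' `F ∧' ¬' `F           ≈⟨ ∨-identityʳ _ ⟨
    (¬' `F ∧' ¬' `F) ∨' `F   ≈⟨ [¬a∧¬F]∨b≈¬[a∧¬b] `F `F ⟩
    ¬' (`F ∧' ¬' `F)         ≈⟨ cong¬ (∧-zeroˡ _) ⟩
    ¬' `F                    ∎

  ¬¬F≈F : ¬' (¬' `F) ≈ `F
  ¬¬F≈F = begin
    ¬' (¬' `F)               ≈⟨ cong¬ ¬F∧¬F≈¬F ⟨
    ¬' (¬' `F ∧' ¬' `F)      ≈⟨ ¬[¬a∧¬F]≈a `F ⟩
    `F                       ∎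

  [¬T∧¬F]∨b≈¬¬b : ∀ b → (¬' `T ∧' ¬' `F) ∨' b ≈ ¬' (¬' b)
  [¬T∧¬F]∨b≈¬¬b b = begin
    (¬' `T ∧' ¬' `F) ∨' b    ≈⟨ [¬a∧¬F]∨b≈¬[a∧¬b] `T b ⟩
    ¬' (`T ∧' ¬' b)          ≈⟨ cong¬ (∧-identityˡ _) ⟩
    ¬' (¬' b)                ∎

  ¬T∧¬F≈F : ¬' `T ∧' ¬' `F ≈ `F
  ¬T∧¬F≈F = begin
    ¬' `T ∧' ¬' `F           ≈⟨ ∨-identityʳ _ ⟨
    (¬' `T ∧' ¬' `F) ∨' `F   ≈⟨ [¬T∧¬F]∨b≈¬¬b `F ⟩
    ¬' (¬' `F)               ≈⟨ ¬¬F≈F ⟩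
    `F                       ∎

  T≈¬F : `T ≈ ¬' `F
  T≈¬F = begin
    `T                       ≈⟨ ¬[¬a∧¬F]≈a `T ⟨
    ¬' (¬' `T ∧' ¬' `F)      ≈⟨ cong¬ ¬T∧¬F≈F ⟩
    ¬' `F                    ∎

  F≈¬T : `F ≈ ¬' `T
  F≈¬T = begin
    `F                       ≈⟨ ¬¬F≈F ⟨
    ¬' (¬' `F)               ≈⟨ cong¬ T≈¬F ⟨
    ¬' `T                    ∎

  F∨T≈T : `F ∨' `T ≈ `T
  F∨T≈T = begin
    `F ∨' `T                 ≈⟨ ∨-definition `F `T ⟩
    ¬' (¬' `F ∧' ¬' `T)      ≈⟨ cong¬ (cong∧ T≈¬F F≈¬T) ⟨
    ¬' (`T ∧' `F)            ≈⟨ cong¬ (∧-identityˡ `F) ⟩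
    ¬' `F                    ≈⟨ T≈¬F ⟨
    `T                       ∎

  ∨-identityˡ : ∀ b → `F ∨' b ≈ b
  ∨-identityˡ b = begin
    `F ∨' b                  ≈⟨ cong∨ (∧-zeroˡ `F) refl ⟨
    (`F ∧' `F) ∨' b          ≈⟨ [∧F]∨≈[∨T]∧ `F b ⟩
    (`F ∨' `T) ∧' b          ≈⟨ cong∧ F∨T≈T refl ⟩
    `T ∧' b                  ≈⟨ ∧-identityˡ b ⟩
    b                        ∎

  ¬-involutive : ∀ b → ¬' (¬' b) ≈ b
  ¬-involutive b = begin
    ¬' (¬' b)                ≈⟨ [¬T∧¬F]∨b≈¬¬b b ⟨
    (¬' `T ∧' ¬' `F) ∨' b    ≈⟨ cong∨ ¬T∧¬F≈F refl ⟩
    `F ∨' b                  ≈⟨ ∨-identityˡ b ⟩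
    b                        ∎

proposition2p8 : (A : Set) → (Ax A ⊢ `F ≈ ¬' `T) × (Ax A ⊢ ¬' (¬' x) ≈ x)
proposition2p8 A = F≈¬T A , ¬-involutive A x
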